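{- Let $g\geq3$, let $m\geq1$ and $n\geq3$ be odd integers, and let $\Gamma=(\mathbb Z_m\times\mathbb Z_{4n})\rtimes\mathbb Z_2$. Then an $RSM_\Gamma(\Gamma,g;[^{1}m,\ ^{8mn-1}2n])$ exists.
   Context: The generalized dihedral group $(\mathbb Z_m\times\mathbb Z_{4n})\rtimes\mathbb Z_2$ has underlying set $(\mathbb Z_m\times\mathbb Z_{4n})\times\mathbb Z_2$ and operation $(u,\tau)+(u',\tau')=(u+(-1)^\tau u',\tau+\tau')$. A list is a multiset; $[^{a}x,\ ^{b}y]$ has $a$ copies of $x$ and $b$ copies of $y$. For $S\subseteq\Gamma$, an $|S|$-list $\Sigma$ and $g\ge2$, a row-sum matrix $RSM_\Gamma(S,g;\Sigma)$ is an $|S|\times g$ matrix with entries in $\Gamma$ each of whose columns is a permutation of $S$, such that the multiset of left-to-right row sums is $\Sigma$. $RSM_\Gamma(S,g;L)$ with $L$ a list of positive integers means an $RSM_\Gamma(S,g;\Sigma)$ for some $\Sigma$ whose list of element orders equals $L$. -}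

module Defs where

open import Data.Nat using (ℕ; zero; suc; _+_; _*_; _∸_; _<_; _≤_)
open import Data.Nat.DivMod using (_mod_)
open import Data.Fin using (Fin; toℕ)
open import Data.Bool using (Bool; true; false; _xor_)
open import Data.Product using (_×_; ∃; _,_)
open import Data.List using (List; replicate; _++_)
import Data.List as List
import Data.Vec.Functional as VF
open import Data.List.Relation.Binary.Pointwise using (Pointwise)
open import Data.List.Relation.Binary.Permutation.Propositional using (_↭_)
open import Function.Definitions using (Bijective)
open import Relation.Binary.PropositionalEquality using (_≡_; _≢_)

zeroF : ∀ {k} → Fin k → Fin k
zeroF {suc k} _ = 0 mod suc k

addF : ∀ {k} → Fin k → Fin k → Fin k
addF {suc k} i j = (toℕ i + toℕ j) mod suc k

negF : ∀ {k} → Fin k → Fin k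
negF {suc k} i = (suc k ∸ toℕ i) mod suc k

-- The generalized dihedral group Γ = (ℤ_m × ℤ_{4n}) ⋊ ℤ_2 ;
-- the ℤ_2 component is a Bool (false = 0, true = 1).
record Γ (m n : ℕ) : Set where
  constructor ⟨_,_,_⟩
  field
    fst : Fin m
    snd : Fin (4 * n)
    tau : Bool
open Γ public

-- (u,τ) + (u',τ') = (u + (-1)^τ u', τ + τ')
_⊕_ : ∀ {m n} → Γ m n → Γ m n → Γ m n
⟨ a , b , false ⟩ ⊕ ⟨ a' , b' , t' ⟩ = ⟨ addF a a' , addF b b' , t' ⟩
⟨ a , b , true  ⟩ ⊕ ⟨ a' , b' , t' ⟩ = ⟨ addF a (negF a') , addF b (negF b') , true xor t' ⟩

ε : ∀ {m n} → Fin m → Fin (4 * n) → Γ m n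
ε a b = ⟨ zeroF a , zeroF b , false ⟩

mul : ∀ {m n} → ℕ → Γ m n → Γ m n
mul zero    x = ε (fst x) (snd x)
mul (suc k) x = x ⊕ mul k x

IsOrder : ∀ {m n} → Γ m n → ℕ → Set
IsOrder x d = 0 < d × mul d x ≡ mul 0 x × (∀ k → 0 < k → k < d → mul k x ≢ mul 0 x)

rowSum : ∀ {m n} g → (Fin (suc g) → Γ m n) → Γ m n
rowSum g r = VF.foldl _⊕_ (r Fin.zero) (VF.tail r)
  where import Data.Fin as Fin

-- An RSM_Γ(Γ, g; Σ): a |Γ| × g matrix over Γ (|Γ| = 2·m·4n) each column of which
-- is a permutation of Γ, with list of row sums Σ.
IsRSM : ∀ {m n} g (M : Fin (m * (4 * n) * 2) → Fin (suc g) → Γ m n) (Σ : List (Γ m n)) → Set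
IsRSM g M Σ = (∀ j → Bijective _≡_ _≡_ (λ i → M i j))
            × Σ ≡ List.tabulate (λ i → rowSum g (M i))

-- RSM_Γ(Γ, g; L) for a list L of positive integers: an RSM_Γ(Γ,g;Σ) for some Σ whose
-- list of element orders equals L (as a multiset).  Number of columns is g = suc g'.
RSM-orders : (m n g' : ℕ) → List ℕ → Set
RSM-orders m n g' L =
  ∃ λ (M : Fin (m * (4 * n) * 2) → Fin (suc g') → Γ m n) →
  ∃ λ (Σ : List (Γ m n)) → ∃ λ (os : List ℕ) →
    IsRSM g' M Σ × Pointwise IsOrder Σ os × os ↭ L

-- Let σ = (0, 2, 0) and ρ = (8, 0, 0) in Γ: σ and σ⁻¹ have order 2n, and ρ has order m because m is
-- odd.  Prepending two columns y, y⁻¹ (y any permutation) leaves every row sum unchanged, so it suffices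
-- to treat three and four columns.  For three columns we use a complete mapping θ of Γ, i.e. θ and
-- x ↦ x ⊕ θ x are both bijections: the columns x, θ x, (x ⊕ θ x)⁻¹ ⊕ σ are permutations and every row
-- sums to σ.  For four columns, x, σ ⊕ x⁻¹, x, x⁻¹ sum to the conjugate x ⊕ σ ⊕ x⁻¹, which is σ or σ⁻¹.
-- Composing the later columns with a 3-cycle on three well-chosen elements changes exactly their three
-- row sums, into ρ, σ and σ⁻¹.  All computations in Γ are done on integer representatives in ℤ² ⋊ ℤ₂,
-- of which Γ is the quotient by mℤ × 4nℤ.

module Submission where

open import Algebra.Bundles using (Group)
open import Algebra.Definitions using (Associative)
import Algebra.Properties.Group as GroupProperties
open import Algebra.Structures using (IsGroup)
open import Data.Bool using (Bool; true; false; _xor_)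
import Data.Bool.Properties as Bool
open import Data.Fin as Fin using (Fin; toℕ; fromℕ<; zero; suc)
open import Data.Fin.Properties
  using (toℕ-fromℕ<; toℕ<n; toℕ-injective; suc-injective; *↔×; 2↔Bool; any?; injective⇒≤; punchOut-injective)
open import Data.Integer as ℤ using (ℤ; +_; ∣_∣)
open import Data.Integer.DivMod using (_%ℕ_; _/ℕ_; n%ℕd<d; a≡a%ℕn+[a/ℕn]*n)
open import Data.Integer.Divisibility.Signed
  using (_∣_; divides; ∣⇒∣ᵤ; ∣-refl; ∣-trans; ∣m∣n⇒∣m+n; ∣m∣n⇒∣m-n; ∣m⇒∣-m; ∣n⇒∣m*n; ∣m⇒∣m*n;
         ∣m+n∣m⇒∣n; *-cancelˡ-∣)
import Data.Integer.Properties as ℤ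
open import Data.Integer.Tactic.RingSolver using (solve-∀)
open import Data.List using (List; _∷_; tabulate; replicate; _++_)
open import Data.List.Properties using (tabulate-cong)
open import Data.List.Relation.Binary.Permutation.Propositional
  using (_↭_; ↭-refl; ↭-reflexive; ↭-trans; prep; swap)
open import Data.List.Relation.Binary.Pointwise using (tabulate⁺)
open import Data.Nat as ℕ using (ℕ; zero; suc; z≤n; s≤s)
open import Data.Nat.DivMod using (m<n⇒m%n≡m)
open import Data.Nat.Divisibility using (_∤_)
import Data.Nat.Divisibility as ℕ
import Data.Nat.Properties as ℕ
import Data.Nat.Tactic.RingSolver as ℕ-Ring
open import Data.Product using (_×_; _,_; proj₁; proj₂; ∃-syntax)
open import Data.Product.Function.NonDependent.Propositional using (_×-↔_)
open import Data.Sum as Sum using (_⊎_; inj₁; inj₂; [_,_]′)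
import Data.Vec.Functional as VF
open import Function using (id; _∘_; case_of_; _↔_; Inverse; mk↔ₛ′)
open import Function.Bundles using (Bijection)
open import Function.Consequences.Propositional using (strictlySurjective⇒surjective)
import Function.Construct.Composition as Composition
open Composition using (_↔-∘_)
open import Function.Definitions using (Injective; Bijective; StrictlySurjective)
open import Function.Properties.Inverse using (↔⇒⤖)
open import Relation.Binary.Definitions using (DecidableEquality)
open import Relation.Binary.PropositionalEquality
open import Relation.Nullary using (¬_; contradiction; Dec; yes; no; map′; does)
open import Relation.Nullary.Decidable using (dec-true; dec-false; _×-dec_)

open import Defs

module Congruence where

  open import Data.Integer using (_+_; _-_; -_; _*_)

  infix 4 _≡_mod_
  record _≡_mod_ (x y : ℤ) (d : ℕ) : Set where
    constructor congruent
    field divides-difference : + d ∣ x - y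

  module _ {d : ℕ} where

    mod-reflexive : ∀ {x y} → x ≡ y → x ≡ y mod d
    mod-reflexive {x} refl = congruent (divides (+ 0) (ℤ.+-inverseʳ x))

    mod-resp : ∀ {x y x′ y′} → x - y ≡ x′ - y′ → x ≡ y mod d → x′ ≡ y′ mod d
    mod-resp eq (congruent d∣x-y) = congruent (subst (+ d ∣_) eq d∣x-y)

    mod-sym : ∀ {x y} → x ≡ y mod d → y ≡ x mod d
    mod-sym {x} {y} (congruent d∣x-y) =
      congruent (subst (+ d ∣_) (difference-swap x y) (∣m⇒∣-m d∣x-y))
      where difference-swap : ∀ x y → - (x - y) ≡ y - x
            difference-swap = solve-∀

    mod-trans : ∀ {x y z} → x ≡ y mod d → y ≡ z mod d → x ≡ z mod d
    mod-trans {x} {y} {z} (congruent d∣x-y) (congruent d∣y-z) =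
      congruent (subst (+ d ∣_) (telescope x y z) (∣m∣n⇒∣m+n d∣x-y d∣y-z))
      where telescope : ∀ x y z → (x - y) + (y - z) ≡ x - z
            telescope = solve-∀

    mod-+ : ∀ {x y u v} → x ≡ y mod d → u ≡ v mod d → x + u ≡ y + v mod d
    mod-+ {x} {y} {u} {v} (congruent d∣x-y) (congruent d∣u-v) =
      congruent (subst (+ d ∣_) (regroup x y u v) (∣m∣n⇒∣m+n d∣x-y d∣u-v))
      where regroup : ∀ x y u v → (x - y) + (u - v) ≡ (x + u) - (y + v)
            regroup = solve-∀

    mod-neg : ∀ {x y} → x ≡ y mod d → - x ≡ - y mod d
    mod-neg {x} {y} (congruent d∣x-y) =
      congruent (subst (+ d ∣_) (neg-difference x y) (∣m⇒∣-m d∣x-y))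
      where neg-difference : ∀ x y → - (x - y) ≡ - x - - y
            neg-difference = solve-∀

    mod-+-cancelˡ : ∀ {c x y} → c + x ≡ c + y mod d → x ≡ y mod d
    mod-+-cancelˡ {c} {x} {y} = mod-resp (cancel c x y)
      where cancel : ∀ c x y → (c + x) - (c + y) ≡ x - y
            cancel = solve-∀

    mod-+-cancelʳ : ∀ {c x y} → x + c ≡ y + c mod d → x ≡ y mod d
    mod-+-cancelʳ {c} {x} {y} = mod-resp (cancel c x y)
      where cancel : ∀ c x y → (x + c) - (y + c) ≡ x - y
            cancel = solve-∀

    mod-neg-cancel : ∀ {x y} → - x ≡ - y mod d → x ≡ y mod d
    mod-neg-cancel {x} {y} = subst₂ (_≡_mod d) (ℤ.neg-involutive x) (ℤ.neg-involutive y) ∘ mod-neg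

    modulus-mod : ∀ x → x + + d ≡ x mod d
    modulus-mod x = congruent (divides (+ 1) (cancel x (+ d)))
      where cancel : ∀ x d → (x + d) - x ≡ + 1 * d
            cancel = solve-∀

    divisible⇒≡0 : ∀ {x} → + d ∣ x → x ≡ + 0 mod d
    divisible⇒≡0 {x} = congruent ∘ subst (+ d ∣_) (sym (ℤ.+-identityʳ x))

    ≡0⇒divisible : ∀ {x} → x ≡ + 0 mod d → + d ∣ x
    ≡0⇒divisible {x} (congruent d∣x-0) = subst (+ d ∣_) (ℤ.+-identityʳ x) d∣x-0

    mod-unique : ∀ {r s} → r ℕ.< d → s ℕ.< d → + r ≡ + s mod d → r ≡ s
    mod-unique {r} {s} r<d s<d r≡s =
      [ (λ r≤s → below r≤s s<d r≡s) , (λ s≤r → sym (below s≤r r<d (mod-sym r≡s))) ]′ (ℕ.≤-total r s)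
      where
      below : ∀ {r s} → r ℕ.≤ s → s ℕ.< d → + r ≡ + s mod d → r ≡ s
      below {r} {s} r≤s s<d (congruent d∣r-s) =
        ℕ.≤-antisym r≤s (ℕ.m∸n≡0⇒m≤n (multiple-below d∣s∸r s∸r<d))
        where
        d∣s∸r : d ℕ.∣ s ℕ.∸ r
        d∣s∸r = subst (d ℕ.∣_) (trans (cong ℤ.∣_∣ (ℤ.m-n≡m⊖n r s)) (ℤ.∣⊖∣-≤ r≤s)) (∣⇒∣ᵤ d∣r-s)
        s∸r<d : s ℕ.∸ r ℕ.< d
        s∸r<d = ℕ.≤-<-trans (ℕ.m∸n≤m s r) s<d
        multiple-below : ∀ {x} → d ℕ.∣ x → x ℕ.< d → x ≡ 0
        multiple-below {zero}  _   _   = refl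
        multiple-below {suc _} d∣x x<d = contradiction (ℕ.∣⇒≤ d∣x) (ℕ.<⇒≱ x<d)

  halve-odd : ∀ t {x} → + suc (2 ℕ.* t) ∣ + 2 * x → + suc (2 ℕ.* t) ∣ x
  halve-odd t {x} m∣2x = subst (_ ∣_) (trans (cong (λ m → x * m - (+ 2 * x) * + t) m≡1+2t) (cancel x (+ t)))
    (∣m∣n⇒∣m-n (∣n⇒∣m*n x ∣-refl) (∣m⇒∣m*n (+ t) m∣2x))
    where
    m≡1+2t : + suc (2 ℕ.* t) ≡ + 1 + + 2 * + t
    m≡1+2t = cong (λ 2t → + 1 + 2t) (ℤ.pos-* 2 t)
    cancel : ∀ x t → x * (+ 1 + + 2 * t) - (+ 2 * x) * t ≡ x
    cancel = solve-∀

  halve-even : ∀ N {x} → + (2 ℕ.* N) ∣ + 2 * x → + N ∣ x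
  halve-even N 2N∣2x = *-cancelˡ-∣ (+ 2) (subst (_∣ _) (ℤ.pos-* 2 N) 2N∣2x)

  even∤odd : ∀ N x → ¬ (+ (2 ℕ.* N) ∣ + 2 * x + + 1)
  even∤odd N x 2N∣2x+1 = contradiction (ℕ.∣1⇒≡1 (∣⇒∣ᵤ 2∣1)) λ ()
    where
    2∣2N : + 2 ∣ + (2 ℕ.* N)
    2∣2N = subst (+ 2 ∣_) (sym (ℤ.pos-* 2 N)) (∣m⇒∣m*n {+ 2} (+ N) ∣-refl)
    2∣1 : + 2 ∣ + 1
    2∣1 = ∣m+n∣m⇒∣n (∣-trans 2∣2N 2N∣2x+1) (∣m⇒∣m*n x ∣-refl)

  mod-halve-odd : ∀ t {x y} → + 2 * x ≡ + 2 * y mod suc (2 ℕ.* t) → x ≡ y mod suc (2 ℕ.* t)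
  mod-halve-odd t {x} {y} (congruent m∣2x-2y) =
    congruent (halve-odd t (subst (_ ∣_) (factor x y) m∣2x-2y))
    where factor : ∀ x y → + 2 * x - + 2 * y ≡ + 2 * (x - y)
          factor = solve-∀

  mod-halve-even : ∀ N {x y} → + 2 * x ≡ + 2 * y mod (2 ℕ.* N) → x ≡ y mod N
  mod-halve-even N {x} {y} (congruent 2N∣2x-2y) =
    congruent (halve-even N (subst (_ ∣_) (factor x y) 2N∣2x-2y))
    where factor : ∀ x y → + 2 * x - + 2 * y ≡ + 2 * (x - y)
          factor = solve-∀

  odd-difference : ∀ N {x y} z → x - y ≡ + 2 * z + + 1 → ¬ (x ≡ y mod (2 ℕ.* N))
  odd-difference N z x-y≡2z+1 (congruent 2N∣x-y) = even∤odd N z (subst (_ ∣_) x-y≡2z+1 2N∣x-y)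

  module Residue (d : ℕ) where

    reduce : ℤ → Fin (suc d)
    reduce x = fromℕ< (n%ℕd<d x (suc d))

    toℕ-reduce : ∀ x → toℕ (reduce x) ≡ x %ℕ suc d
    toℕ-reduce x = toℕ-fromℕ< (n%ℕd<d x (suc d))

    reduce-mod : ∀ x → + toℕ (reduce x) ≡ x mod suc d
    reduce-mod x = congruent (divides (- (x /ℕ suc d)) (begin
      + toℕ (reduce x) - x              ≡⟨ cong₂ _-_ (cong +_ (toℕ-reduce x))
                                                      (a≡a%ℕn+[a/ℕn]*n x (suc d)) ⟩
      + r - (+ r + q * + suc d)        ≡⟨ cancel (+ r) q (+ suc d) ⟩
      - q * + suc d                     ∎))
      where
      open ≡-Reasoning
      r = x %ℕ suc d
      q = x /ℕ suc d
      cancel : ∀ r q D → r - (r + q * D) ≡ - q * D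
      cancel = solve-∀

    reduce-cong : ∀ {x y} → x ≡ y mod suc d → reduce x ≡ reduce y
    reduce-cong {x} {y} x≡y = toℕ-injective (mod-unique (toℕ<n (reduce x)) (toℕ<n (reduce y))
      (mod-trans (reduce-mod x) (mod-trans x≡y (mod-sym (reduce-mod y)))))

    reduce-injective : ∀ {x y} → reduce x ≡ reduce y → x ≡ y mod suc d
    reduce-injective {x} {y} eq = mod-trans (mod-sym (reduce-mod x))
      (mod-trans (mod-reflexive (cong (λ i → + toℕ i) eq)) (reduce-mod y))

    toℕ-reduce-small : ∀ {k} → k ℕ.< suc d → toℕ (reduce (+ k)) ≡ k
    toℕ-reduce-small {k} k<D = trans (toℕ-reduce (+ k)) (m<n⇒m%n≡m k<D)

    reduce-toℕ : ∀ i → reduce (+ toℕ i) ≡ i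
    reduce-toℕ i = toℕ-injective (toℕ-reduce-small (toℕ<n i))

    addF-reduce : ∀ x y → addF (reduce x) (reduce y) ≡ reduce (x + y)
    addF-reduce x y = reduce-cong (mod-trans (mod-reflexive (ℤ.pos-+ (toℕ (reduce x)) (toℕ (reduce y))))
                                             (mod-+ (reduce-mod x) (reduce-mod y)))

    negF-reduce : ∀ x → negF (reduce x) ≡ reduce (- x)
    negF-reduce x = reduce-cong (mod-trans (mod-reflexive D∸r≡D-r) D-r≡-x)
      where
      r = toℕ (reduce x)
      D∸r≡D-r : + (suc d ℕ.∸ r) ≡ + suc d - + r
      D∸r≡D-r = sym (trans (ℤ.m-n≡m⊖n (suc d) r) (ℤ.⊖-≥ (ℕ.<⇒≤ (toℕ<n (reduce x)))))
      regroup : ∀ D r x → (+ 0 + D) + x - (+ 0 + r) ≡ (D - r) - - x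
      regroup = solve-∀
      D-r≡-x : + suc d - + r ≡ - x mod suc d
      D-r≡-x = mod-resp (regroup (+ suc d) (+ r) x) (mod-+ (modulus-mod (+ 0)) (mod-sym (reduce-mod x)))

  module Halves (N : ℕ) {K} (K≡N+N : K ≡ N ℕ.+ N) where

    upper : Fin K → Bool
    upper b = does (N ℕ.≤? toℕ b)

    data HalfView (b : Fin K) : Bool → Set where
      lower-half : toℕ b ℕ.< N → HalfView b false
      upper-half : ∀ r → r ℕ.< N → toℕ b ≡ N ℕ.+ r → HalfView b true

    half-view : ∀ b → HalfView b (upper b)
    half-view b = view (N ℕ.≤? toℕ b)
      where
      view : (N≤?b : Dec (N ℕ.≤ toℕ b)) → HalfView b (does N≤?b)
      view (yes N≤b) = upper-half (toℕ b ℕ.∸ N) r<N (sym (ℕ.m+[n∸m]≡n N≤b))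
        where
        r<N : toℕ b ℕ.∸ N ℕ.< N
        r<N = ℕ.+-cancelˡ-< N _ _ (subst₂ ℕ._<_ (sym (ℕ.m+[n∸m]≡n N≤b)) K≡N+N (toℕ<n b))
      view (no N≰b)  = lower-half (ℕ.≰⇒> N≰b)

    upper-false : ∀ {b} → toℕ b ℕ.< N → upper b ≡ false
    upper-false b<N = dec-false (N ℕ.≤? _) (ℕ.<⇒≱ b<N)

    upper-true : ∀ {b} → N ℕ.≤ toℕ b → upper b ≡ true
    upper-true N≤b = dec-true (N ℕ.≤? _) N≤b

    same-half-unique : ∀ {b b′} → upper b ≡ upper b′ → + toℕ b ≡ + toℕ b′ mod N → b ≡ b′
    same-half-unique {b} {b′} same b≡b′ with upper b | half-view b | upper b′ | half-view b′
    ... | false | lower-half b<N | false | lower-half b′<N = toℕ-injective (mod-unique b<N b′<N b≡b′)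
    ... | true | upper-half r r<N b≡N+r | true | upper-half r′ r′<N b′≡N+r′ =
      toℕ-injective (trans b≡N+r (trans (cong (N ℕ.+_) r≡r′) (sym b′≡N+r′)))
      where
      shift : ∀ N r r′ → (N + r) - (N + r′) ≡ r - r′
      shift = solve-∀
      r≡r′ : r ≡ r′
      r≡r′ = mod-unique r<N r′<N
        (mod-resp (trans (cong₂ (λ u v → + u - + v) b≡N+r b′≡N+r′) (shift (+ N) (+ r) (+ r′))) b≡b′)
    same-half-unique () _ | false | _ | true | _
    same-half-unique () _ | true | _ | false | _

    small-sum-nonzero : ∀ {u v} → u ℕ.< N → v ℕ.< N → ¬ (+ 1 + (+ u + + v) ≡ + 0 mod K)
    small-sum-nonzero {u} {v} u<N v<N 1+u+v≡0 = case mod-unique 1+u+v<K 0<K 1+u+v≡0 of λ ()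
      where
      1+u+v<K : suc (u ℕ.+ v) ℕ.< K
      1+u+v<K = subst (suc (u ℕ.+ v) ℕ.<_) (sym K≡N+N)
        (ℕ.≤-trans (ℕ.≤-reflexive (cong suc (sym (ℕ.+-suc u v)))) (ℕ.+-mono-≤ u<N v<N))
      0<K : 0 ℕ.< K
      0<K = ℕ.≤-<-trans ℕ.z≤n 1+u+v<K

    same-half-sum : ∀ {b b′} → upper b ≡ upper b′ → ¬ (+ 1 + (+ toℕ b + + toℕ b′) ≡ + 0 mod K)
    same-half-sum {b} {b′} same with upper b | half-view b | upper b′ | half-view b′
    ... | false | lower-half b<N | false | lower-half b′<N = small-sum-nonzero b<N b′<N
    ... | true | upper-half r r<N b≡N+r | true | upper-half r′ r′<N b′≡N+r′ =
      small-sum-nonzero r<N r′<N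
        ∘ mod-trans (mod-trans (mod-sym (modulus-mod _)) (mod-reflexive (cong +_ wrap)))
      where
      regroup : ∀ N r r′ → 1 ℕ.+ (r ℕ.+ r′) ℕ.+ (N ℕ.+ N) ≡ 1 ℕ.+ ((N ℕ.+ r) ℕ.+ (N ℕ.+ r′))
      regroup = ℕ-Ring.solve-∀
      wrap : 1 ℕ.+ (r ℕ.+ r′) ℕ.+ K ≡ 1 ℕ.+ (toℕ b ℕ.+ toℕ b′)
      wrap = trans (cong (1 ℕ.+ (r ℕ.+ r′) ℕ.+_) K≡N+N)
                   (trans (regroup N r r′) (cong₂ (λ u v → 1 ℕ.+ (u ℕ.+ v)) (sym b≡N+r) (sym b′≡N+r′)))
    ... | false | _ | true | _ = λ _ → case same of λ ()
    ... | true | _ | false | _ = λ _ → case same of λ ()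

open Congruence

injective⇒strictlySurjective : ∀ {N} {f : Fin N → Fin N} → Injective _≡_ _≡_ f → StrictlySurjective _≡_ f
injective⇒strictlySurjective {suc N} {f} f-inj y with any? (λ i → f i Fin.≟ y)
... | yes hit = hit
... | no miss = contradiction (injective⇒≤ g-inj) ℕ.1+n≰n
  where
  y≢f : ∀ i → y ≢ f i
  y≢f i y≡fi = miss (i , sym y≡fi)
  g : Fin (suc N) → Fin N
  g i = Fin.punchOut (y≢f i)
  g-inj : Injective _≡_ _≡_ g
  g-inj eq = f-inj (punchOut-injective (y≢f _) (y≢f _) eq)

module Finite {A : Set} {N} (Fin↔A : Fin N ↔ A) where
  open Inverse Fin↔A

  from-injective : Injective _≡_ _≡_ from
  from-injective {a} {b} eq = trans (sym (strictlyInverseˡ a)) (trans (cong to eq) (strictlyInverseˡ b))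

  to-injective : Injective _≡_ _≡_ to
  to-injective {i} {j} eq = trans (sym (strictlyInverseʳ i)) (trans (cong from eq) (strictlyInverseʳ j))

  injective⇒bijective : ∀ {f : A → A} → Injective _≡_ _≡_ f → Bijective _≡_ _≡_ f
  injective⇒bijective {f} f-inj = f-inj , strictlySurjective⇒surjective surj
    where
    surj : StrictlySurjective _≡_ f
    surj y with injective⇒strictlySurjective (to-injective ∘ f-inj ∘ from-injective) (from y)
    ... | i , hi≡y = to i , from-injective hi≡y

tabulate-↭-single : ∀ {A : Set} {N} (f : Fin (suc N) → A) (i : Fin (suc N)) {a b} →
                    f i ≡ a → (∀ j → j ≢ i → f j ≡ b) → tabulate f ↭ a ∷ replicate N b
tabulate-↭-single {N = N} f zero fi≡a others =
  ↭-reflexive (cong₂ _∷_ fi≡a (constant N (f ∘ suc) (λ j → others (suc j) λ ())))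
  where
  constant : ∀ {A : Set} {b : A} N (g : Fin N → A) → (∀ j → g j ≡ b) → tabulate g ≡ replicate N b
  constant zero    g _     = refl
  constant (suc N) g g≡b = cong₂ _∷_ (g≡b zero) (constant N (g ∘ suc) (g≡b ∘ suc))
tabulate-↭-single {N = suc N} f (suc i) {a} {b} fi≡a others = ↭-trans
  (prep (f zero) (tabulate-↭-single (f ∘ suc) i fi≡a (λ j j≢i → others (suc j) (j≢i ∘ suc-injective))))
  (subst (λ c → c ∷ a ∷ replicate N b ↭ a ∷ b ∷ replicate N b) (sym (others zero λ ())) (swap b a ↭-refl))

module _ {A : Set} (_≟_ : DecidableEquality A) where

  -- Opaque, so that type checking never unfolds a transposition of concrete elements of Γ.
  opaque
    transpose : A → A → A → A
    transpose p q x with x ≟ p | x ≟ q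
    ... | yes _ | _     = q
    ... | no _  | yes _ = p
    ... | no _  | no _  = x

    transpose-p : ∀ p q → transpose p q p ≡ q
    transpose-p p q with p ≟ p | p ≟ q
    ... | yes _   | _ = refl
    ... | no p≢p  | _ = contradiction refl p≢p

    transpose-q : ∀ p q → transpose p q q ≡ p
    transpose-q p q with q ≟ p | q ≟ q
    ... | yes q≡p | _       = q≡p
    ... | no _    | yes _   = refl
    ... | no _    | no q≢q  = contradiction refl q≢q

    transpose-fixes : ∀ {p q x} → x ≢ p → x ≢ q → transpose p q x ≡ x
    transpose-fixes {p} {q} {x} x≢p x≢q with x ≟ p | x ≟ q
    ... | yes x≡p | _       = contradiction x≡p x≢p
    ... | no _    | yes x≡q = contradiction x≡q x≢q
    ... | no _    | no _    = refl

    transpose-involutive : ∀ p q x → transpose p q (transpose p q x) ≡ x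
    transpose-involutive p q x with x ≟ p | x ≟ q
    ... | yes refl | _        = transpose-q p q
    ... | no _     | yes refl = transpose-p p q
    ... | no x≢p   | no x≢q   = transpose-fixes x≢p x≢q

  transpose-injective : ∀ p q → Injective _≡_ _≡_ (transpose p q)
  transpose-injective p q {x} {y} eq =
    trans (sym (transpose-involutive p q x)) (trans (cong (transpose p q) eq) (transpose-involutive p q y))

  module ThreeCycle {p q r : A} (p≢q : p ≢ q) (q≢r : q ≢ r) (p≢r : p ≢ r) where

    cycle cycle⁻¹ : A → A
    cycle   = transpose p q ∘ transpose q r
    cycle⁻¹ = transpose q r ∘ transpose p q

    cycle-injective : Injective _≡_ _≡_ cycle
    cycle-injective = transpose-injective q r ∘ transpose-injective p q

    cycle⁻¹-injective : Injective _≡_ _≡_ cycle⁻¹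
    cycle⁻¹-injective = transpose-injective p q ∘ transpose-injective q r

    cycle-p : cycle p ≡ q
    cycle-p = trans (cong (transpose p q) (transpose-fixes p≢q p≢r)) (transpose-p p q)

    cycle-q : cycle q ≡ r
    cycle-q = trans (cong (transpose p q) (transpose-p q r)) (transpose-fixes (≢-sym p≢r) (≢-sym q≢r))

    cycle-r : cycle r ≡ p
    cycle-r = trans (cong (transpose p q) (transpose-q q r)) (transpose-q p q)

    cycle⁻¹-p : cycle⁻¹ p ≡ r
    cycle⁻¹-p = trans (cong (transpose q r) (transpose-p p q)) (transpose-p q r)

    cycle⁻¹-q : cycle⁻¹ q ≡ p
    cycle⁻¹-q = trans (cong (transpose q r) (transpose-q p q)) (transpose-fixes p≢q p≢r)

    cycle⁻¹-r : cycle⁻¹ r ≡ q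
    cycle⁻¹-r = trans (cong (transpose q r) (transpose-fixes (≢-sym p≢r) (≢-sym q≢r))) (transpose-q q r)

    cycle-fixes : ∀ {x} → x ≢ p → x ≢ q → x ≢ r → cycle x ≡ x
    cycle-fixes x≢p x≢q x≢r = trans (cong (transpose p q) (transpose-fixes x≢q x≢r)) (transpose-fixes x≢p x≢q)

    cycle⁻¹-fixes : ∀ {x} → x ≢ p → x ≢ q → x ≢ r → cycle⁻¹ x ≡ x
    cycle⁻¹-fixes x≢p x≢q x≢r = trans (cong (transpose q r) (transpose-fixes x≢p x≢q)) (transpose-fixes x≢q x≢r)

    other-than-p : ∀ {ℓ} (M : A → Set ℓ) → M q → M r → (∀ {x} → x ≢ p → x ≢ q → x ≢ r → M x) →
                   ∀ x → x ≢ p → M x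
    other-than-p M at-q at-r elsewhere x x≢p = split (x ≟ q) (x ≟ r)
      where
      split : Dec (x ≡ q) → Dec (x ≡ r) → M x
      split (yes refl) _          = at-q
      split (no _)     (yes refl) = at-r
      split (no x≢q)   (no x≢r)   = elsewhere x≢p x≢q x≢r

module Dihedral where

  open import Data.Integer using (_+_; _-_; -_; _*_)

  Dihℤ : Set
  Dihℤ = ℤ × ℤ × Bool

  infixl 7 _·_
  _·_ : Dihℤ → Dihℤ → Dihℤ
  (a , b , false) · (a′ , b′ , τ′) = (a + a′ , b + b′ , τ′)
  (a , b , true)  · (a′ , b′ , τ′) = (a - a′ , b - b′ , true xor τ′)

  invℤ : Dihℤ → Dihℤ
  invℤ (a , b , false) = (- a , - b , false)
  invℤ (a , b , true)  = (a , b , true)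

  1ℤ : Dihℤ
  1ℤ = (+ 0 , + 0 , false)

  dihℤ-≡ : ∀ {a a′ b b′ τ} → a ≡ a′ → b ≡ b′ → _≡_ {A = Dihℤ} (a , b , τ) (a′ , b′ , τ)
  dihℤ-≡ refl refl = refl

  ·-assoc : ∀ X Y Z → (X · Y) · Z ≡ X · (Y · Z)
  ·-assoc (a , b , false) (a′ , b′ , false) (a″ , b″ , τ″) = dihℤ-≡ (ℤ.+-assoc a a′ a″) (ℤ.+-assoc b b′ b″)
  ·-assoc (a , b , false) (a′ , b′ , true)  (a″ , b″ , τ″) =
    dihℤ-≡ (ℤ.+-assoc a a′ (- a″)) (ℤ.+-assoc b b′ (- b″))
  ·-assoc (a , b , true)  (a′ , b′ , false) (a″ , b″ , τ″) = dihℤ-≡ (sub-sub a a′ a″) (sub-sub b b′ b″)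
    where sub-sub : ∀ x y z → x - y - z ≡ x - (y + z)
          sub-sub = solve-∀
  ·-assoc (a , b , true)  (a′ , b′ , true)  (a″ , b″ , τ″) =
    trans (dihℤ-≡ (sub-add a a′ a″) (sub-add b b′ b″)) (cong (λ τ → (_ , _ , τ)) (sym (Bool.not-involutive τ″)))
    where sub-add : ∀ x y z → x - y + z ≡ x - (y - z)
          sub-add = solve-∀

  ·-identityˡ : ∀ X → 1ℤ · X ≡ X
  ·-identityˡ (a , b , τ) = dihℤ-≡ (ℤ.+-identityˡ a) (ℤ.+-identityˡ b)

  ·-identityʳ : ∀ X → X · 1ℤ ≡ X
  ·-identityʳ (a , b , false) = dihℤ-≡ (ℤ.+-identityʳ a) (ℤ.+-identityʳ b)
  ·-identityʳ (a , b , true)  = dihℤ-≡ (ℤ.+-identityʳ a) (ℤ.+-identityʳ b)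

  invℤ-inverseˡ : ∀ X → invℤ X · X ≡ 1ℤ
  invℤ-inverseˡ (a , b , false) = dihℤ-≡ (ℤ.+-inverseˡ a) (ℤ.+-inverseˡ b)
  invℤ-inverseˡ (a , b , true)  = dihℤ-≡ (ℤ.+-inverseʳ a) (ℤ.+-inverseʳ b)

  invℤ-inverseʳ : ∀ X → X · invℤ X ≡ 1ℤ
  invℤ-inverseʳ (a , b , false) = dihℤ-≡ (ℤ.+-inverseʳ a) (ℤ.+-inverseʳ b)
  invℤ-inverseʳ (a , b , true)  = dihℤ-≡ (ℤ.+-inverseʳ a) (ℤ.+-inverseʳ b)

open Dihedral

IsOrder-intro : ∀ {m n} {x : Γ m n} {d} → 0 ℕ.< d → mul d x ≡ mul 0 x →
                (∀ k → mul k x ≡ mul 0 x → d ℕ.∣ k) → IsOrder x d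
IsOrder-intro {x = x} {d} 0<d dx≡0 minimal = 0<d , dx≡0 , below
  where
  below : ∀ k → 0 ℕ.< k → k ℕ.< d → mul k x ≢ mul 0 x
  below (suc k) _ k<d kx≡0 = ℕ.<⇒≱ k<d (ℕ.∣⇒≤ (minimal (suc k) kx≡0))

IsOrder-resp : ∀ {m n} {x y : Γ m n} {d} → x ≡ y → IsOrder y d → IsOrder x d
IsOrder-resp refl x-order = x-order

module Quotient (dm dn : ℕ) where

  open import Data.Integer using (_+_; _-_; -_; _*_)


  m n K : ℕ
  m = suc dm
  n = suc dn
  K = 4 ℕ.* n

  module Rₘ = Residue dm
  module Rₖ = Residue (dn ℕ.+ 3 ℕ.* n)

  G : Set
  G = Γ m n

  ⟦_⟧ : Dihℤ → G
  ⟦ a , b , τ ⟧ = ⟨ Rₘ.reduce a , Rₖ.reduce b , τ ⟩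

  lift : G → Dihℤ
  lift ⟨ a , b , τ ⟩ = (+ toℕ a , + toℕ b , τ)

  ⟦lift⟧ : ∀ x → ⟦ lift x ⟧ ≡ x
  ⟦lift⟧ ⟨ a , b , τ ⟩ = cong₂ (λ a b → ⟨ a , b , τ ⟩) (Rₘ.reduce-toℕ a) (Rₖ.reduce-toℕ b)

  ⟦⟧-cong : ∀ {a a′ b b′ τ} → a ≡ a′ mod m → b ≡ b′ mod K → ⟦ a , b , τ ⟧ ≡ ⟦ a′ , b′ , τ ⟧
  ⟦⟧-cong {τ = τ} a≡a′ b≡b′ = cong₂ (λ a b → ⟨ a , b , τ ⟩) (Rₘ.reduce-cong a≡a′) (Rₖ.reduce-cong b≡b′)

  infix 4 _∼_
  _∼_ : Dihℤ → Dihℤ → Set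
  (a , b , τ) ∼ (a′ , b′ , τ′) = a ≡ a′ mod m × b ≡ b′ mod K × τ ≡ τ′

  ⟦⟧-injective : ∀ X Y → ⟦ X ⟧ ≡ ⟦ Y ⟧ → X ∼ Y
  ⟦⟧-injective (a , b , τ) (a′ , b′ , τ′) eq =
    Rₘ.reduce-injective (cong fst eq) , Rₖ.reduce-injective (cong snd eq) , cong tau eq

  lift-mod-injective : ∀ {a a′ b b′ τ} → + toℕ a ≡ + toℕ a′ mod m → + toℕ b ≡ + toℕ b′ mod K →
                       ⟨ a , b , τ ⟩ ≡ ⟨ a′ , b′ , τ ⟩
  lift-mod-injective a≡a′ b≡b′ = trans (sym (⟦lift⟧ _)) (trans (⟦⟧-cong a≡a′ b≡b′) (⟦lift⟧ _))

  ⟦⟧-hom : ∀ X Y → ⟦ X ⟧ ⊕ ⟦ Y ⟧ ≡ ⟦ X · Y ⟧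
  ⟦⟧-hom (a , b , false) (a′ , b′ , τ′) =
    cong₂ (λ a b → ⟨ a , b , τ′ ⟩) (Rₘ.addF-reduce a a′) (Rₖ.addF-reduce b b′)
  ⟦⟧-hom (a , b , true)  (a′ , b′ , τ′) = cong₂ (λ a b → ⟨ a , b , true xor τ′ ⟩)
    (trans (cong (addF (Rₘ.reduce a)) (Rₘ.negF-reduce a′)) (Rₘ.addF-reduce a (- a′)))
    (trans (cong (addF (Rₖ.reduce b)) (Rₖ.negF-reduce b′)) (Rₖ.addF-reduce b (- b′)))

  infix 30 _⁻¹
  _⁻¹ : G → G
  ⟨ a , b , false ⟩ ⁻¹ = ⟨ negF a , negF b , false ⟩
  ⟨ a , b , true ⟩  ⁻¹ = ⟨ a , b , true ⟩

  ⟦⟧-inv : ∀ X → ⟦ X ⟧ ⁻¹ ≡ ⟦ invℤ X ⟧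
  ⟦⟧-inv (a , b , false) = cong₂ (λ a b → ⟨ a , b , false ⟩) (Rₘ.negF-reduce a) (Rₖ.negF-reduce b)
  ⟦⟧-inv (a , b , true)  = refl

  e : G
  e = ⟦ 1ℤ ⟧

  data Lifted : G → Set where
    lifted : ∀ X → Lifted ⟦ X ⟧

  lifted-view : ∀ x → Lifted x
  lifted-view x = subst Lifted (⟦lift⟧ x) (lifted (lift x))

  ⊕-assoc : Associative _≡_ _⊕_
  ⊕-assoc x y z with lifted-view x | lifted-view y | lifted-view z
  ... | lifted X | lifted Y | lifted Z = begin
    (⟦ X ⟧ ⊕ ⟦ Y ⟧) ⊕ ⟦ Z ⟧  ≡⟨ cong (_⊕ ⟦ Z ⟧) (⟦⟧-hom X Y) ⟩
    ⟦ X · Y ⟧ ⊕ ⟦ Z ⟧        ≡⟨ ⟦⟧-hom (X · Y) Z ⟩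
    ⟦ (X · Y) · Z ⟧          ≡⟨ cong ⟦_⟧ (·-assoc X Y Z) ⟩
    ⟦ X · (Y · Z) ⟧          ≡⟨ ⟦⟧-hom X (Y · Z) ⟨
    ⟦ X ⟧ ⊕ ⟦ Y · Z ⟧        ≡⟨ cong (⟦ X ⟧ ⊕_) (⟦⟧-hom Y Z) ⟨
    ⟦ X ⟧ ⊕ (⟦ Y ⟧ ⊕ ⟦ Z ⟧)  ∎
    where open ≡-Reasoning

  Γ-isGroup : IsGroup _≡_ _⊕_ e _⁻¹
  Γ-isGroup = record
    { isMonoid = record
      { isSemigroup = record
        { isMagma = record { isEquivalence = isEquivalence ; ∙-cong = cong₂ _⊕_ }
        ; assoc = ⊕-assoc }
      ; identity = identityˡ , identityʳ }
    ; inverse = inverseˡ , inverseʳ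
    ; ⁻¹-cong = cong _⁻¹ }
    where
    identityˡ : ∀ x → e ⊕ x ≡ x
    identityˡ x with lifted-view x
    ... | lifted X = trans (⟦⟧-hom 1ℤ X) (cong ⟦_⟧ (·-identityˡ X))
    identityʳ : ∀ x → x ⊕ e ≡ x
    identityʳ x with lifted-view x
    ... | lifted X = trans (⟦⟧-hom X 1ℤ) (cong ⟦_⟧ (·-identityʳ X))
    inverseˡ : ∀ x → x ⁻¹ ⊕ x ≡ e
    inverseˡ x with lifted-view x
    ... | lifted X = trans (cong (_⊕ ⟦ X ⟧) (⟦⟧-inv X)) (trans (⟦⟧-hom (invℤ X) X) (cong ⟦_⟧ (invℤ-inverseˡ X)))
    inverseʳ : ∀ x → x ⊕ x ⁻¹ ≡ e
    inverseʳ x with lifted-view x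
    ... | lifted X = trans (cong (⟦ X ⟧ ⊕_) (⟦⟧-inv X)) (trans (⟦⟧-hom X (invℤ X)) (cong ⟦_⟧ (invℤ-inverseʳ X)))

  Γ-group : Group _ _
  Γ-group = record { isGroup = Γ-isGroup }

  open Group Γ-group using (identityˡ; inverseʳ)
  open GroupProperties Γ-group using (⁻¹-injective)

  mul-rotation : ∀ k a b → mul k ⟦ a , b , false ⟧ ≡ ⟦ + k * a , + k * b , false ⟧
  mul-rotation zero    a b = refl
  mul-rotation (suc k) a b = begin
    ⟦ a , b , false ⟧ ⊕ mul k ⟦ a , b , false ⟧         ≡⟨ cong (⟦ a , b , false ⟧ ⊕_) (mul-rotation k a b) ⟩
    ⟦ a , b , false ⟧ ⊕ ⟦ + k * a , + k * b , false ⟧  ≡⟨ ⟦⟧-hom (a , b , false) _ ⟩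
    ⟦ a + + k * a , b + + k * b , false ⟧
      ≡⟨ cong ⟦_⟧ (dihℤ-≡ (sym (ℤ.suc-* (+ k) a)) (sym (ℤ.suc-* (+ k) b))) ⟩
    ⟦ + suc k * a , + suc k * b , false ⟧             ∎
    where open ≡-Reasoning

  rotation-order : ∀ {a b d} → 0 ℕ.< d → + m ∣ + d * a → + K ∣ + d * b →
                   (∀ k → + m ∣ + k * a → + K ∣ + k * b → d ℕ.∣ k) → IsOrder ⟦ a , b , false ⟧ d
  rotation-order {a} {b} {d} 0<d m∣da K∣db minimal = IsOrder-intro 0<d
    (trans (mul-rotation d a b) (⟦⟧-cong (divisible⇒≡0 m∣da) (divisible⇒≡0 K∣db)))
    minimal′
    where
    minimal′ : ∀ k → mul k ⟦ a , b , false ⟧ ≡ mul 0 ⟦ a , b , false ⟧ → d ℕ.∣ k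
    minimal′ k kx≡0 with ⟦⟧-injective (+ k * a , + k * b , false) 1ℤ (trans (sym (mul-rotation k a b)) kx≡0)
    ... | ka≡0 , kb≡0 , _ = minimal k (≡0⇒divisible ka≡0) (≡0⇒divisible kb≡0)

  Fin↔Γ : Fin (m ℕ.* K ℕ.* 2) ↔ G
  Fin↔Γ = triple↔Γ ↔-∘ ((*↔× ×-↔ 2↔Bool) ↔-∘ *↔×)
    where
    triple↔Γ : ((Fin m × Fin K) × Bool) ↔ G
    triple↔Γ = mk↔ₛ′ (λ ((a , b) , τ) → ⟨ a , b , τ ⟩) (λ x → (fst x , snd x) , tau x) (λ _ → refl) (λ _ → refl)

  open Finite Fin↔Γ using (injective⇒bijective)

  infix 4 _≟Γ_
  _≟Γ_ : DecidableEquality G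
  ⟨ a , b , τ ⟩ ≟Γ ⟨ a′ , b′ , τ′ ⟩ =
    map′ (λ { (refl , refl , refl) → refl }) (λ x≡y → cong fst x≡y , cong snd x≡y , cong tau x≡y)
         (a Fin.≟ a′ ×-dec b Fin.≟ b′ ×-dec τ Bool.≟ τ′)

  tau-apart : ∀ {x y : G} → tau x ≢ tau y → x ≢ y
  tau-apart τx≢τy = τx≢τy ∘ cong tau

  rsm-one-exceptional : ∀ {g a b} (row : G → Fin (suc g) → G) (x₀ : G) →
    (∀ j → Injective _≡_ _≡_ (λ x → row x j)) →
    IsOrder (rowSum g (row x₀)) a → (∀ x → x ≢ x₀ → IsOrder (rowSum g (row x)) b) →
    RSM-orders m n g (a ∷ replicate (m ℕ.* K ℕ.* 2 ℕ.∸ 1) b)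
  rsm-one-exceptional {g} {a} {b} row x₀ columns-injective exceptional generic =
    row ∘ to , tabulate (rowSum g ∘ row ∘ to) , tabulate (order ∘ to) ,
    (columns , refl) , tabulate⁺ (row-order ∘ to) , orders-↭
    where
    open Inverse Fin↔Γ
    columns : ∀ j → Bijective _≡_ _≡_ (λ i → row (to i) j)
    columns j = Composition.bijective _≡_ _≡_ _≡_ (Bijection.bijective (↔⇒⤖ Fin↔Γ))
                                                  (injective⇒bijective (columns-injective j))
    order : G → ℕ
    order x with x ≟Γ x₀
    ... | yes _ = a
    ... | no _  = b
    row-order : ∀ x → IsOrder (rowSum g (row x)) (order x)
    row-order x with x ≟Γ x₀
    ... | yes refl = exceptional
    ... | no x≢x₀  = generic x x≢x₀
    order-x₀ : order x₀ ≡ a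
    order-x₀ with x₀ ≟Γ x₀
    ... | yes _     = refl
    ... | no x₀≢x₀  = contradiction refl x₀≢x₀
    order-other : ∀ x → x ≢ x₀ → order x ≡ b
    order-other x x≢x₀ with x ≟Γ x₀
    ... | yes x≡x₀ = contradiction x≡x₀ x≢x₀
    ... | no _     = refl
    orders-↭ : tabulate (order ∘ to) ↭ a ∷ replicate (m ℕ.* K ℕ.* 2 ℕ.∸ 1) b
    orders-↭ = tabulate-↭-single (order ∘ to) (from x₀) (trans (cong order (strictlyInverseˡ x₀)) order-x₀)
      (λ i i≢ → order-other (to i) (λ to-i≡x₀ → i≢ (trans (sym (strictlyInverseʳ i)) (cong from to-i≡x₀))))

  rsm-pad : ∀ {g L} → RSM-orders m n g L → RSM-orders m n (2 ℕ.+ g) L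
  rsm-pad {g} (M , Σ , os , (columns , Σ≡) , orders , os↭L) =
    M′ , Σ , os , (columns′ , trans Σ≡ (tabulate-cong rows)) , orders , os↭L
    where
    M′ : Fin (m ℕ.* K ℕ.* 2) → Fin (3 ℕ.+ g) → G
    M′ i zero             = M i zero
    M′ i (suc zero)       = M i zero ⁻¹
    M′ i (suc (suc j))    = M i j
    columns′ : ∀ j → Bijective _≡_ _≡_ (λ i → M′ i j)
    columns′ zero          = columns zero
    columns′ (suc zero)    = Composition.bijective _≡_ _≡_ _≡_ (columns zero) (injective⇒bijective ⁻¹-injective)
    columns′ (suc (suc j)) = columns j
    rows : ∀ i → rowSum g (M i) ≡ rowSum (2 ℕ.+ g) (M′ i)
    rows i = cong (λ z → VF.foldl _⊕_ z (VF.tail (M i)))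
                  (sym (trans (cong (_⊕ M i zero) (inverseʳ (M i zero))) (identityˡ (M i zero))))

  rsm-from-bases : ∀ {L} → RSM-orders m n 2 L → RSM-orders m n 3 L → ∀ g → 2 ℕ.≤ g → RSM-orders m n g L
  rsm-from-bases three four 1 (s≤s ())
  rsm-from-bases three four 2 _ = three
  rsm-from-bases three four 3 _ = four
  rsm-from-bases three four (suc (suc g@(suc (suc _)))) _ =
    rsm-pad (rsm-from-bases three four g (s≤s (s≤s z≤n)))

module Construction (t d : ℕ) where

  open import Data.Integer using (_+_; _-_; -_; _*_)

  open Quotient (2 ℕ.* t) (suc d)
  open Group Γ-group using (_\\_; _//_)
  open GroupProperties Γ-group using (\\-leftDividesˡ; //-rightDividesʳ; ⁻¹-injective; ∙-cancelˡ; ∙-cancelʳ)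

  N : ℕ
  N = 2 ℕ.* n

  K≡N+N : K ≡ N ℕ.+ N
  K≡N+N = quadruple n
    where quadruple : ∀ n → 4 ℕ.* n ≡ 2 ℕ.* n ℕ.+ 2 ℕ.* n
          quadruple = ℕ-Ring.solve-∀

  K≡2N : K ≡ 2 ℕ.* N
  K≡2N = quadruple n
    where quadruple : ∀ n → 4 ℕ.* n ≡ 2 ℕ.* (2 ℕ.* n)
          quadruple = ℕ-Ring.solve-∀

  2<N : 2 ℕ.< N
  2<N = ℕ.≤-trans (s≤s (s≤s (s≤s z≤n))) (ℕ.*-monoʳ-≤ 2 (s≤s (s≤s z≤n)))

  halve-K : ∀ {x y} → + 2 * x ≡ + 2 * y mod K → x ≡ y mod N
  halve-K {x} {y} = mod-halve-even N ∘ subst (+ 2 * x ≡ + 2 * y mod_) K≡2N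

  odd-difference-K : ∀ {x y z} → x - y ≡ + 2 * z + + 1 → ¬ (x ≡ y mod K)
  odd-difference-K {x} {y} {z} eq = odd-difference N z eq ∘ subst (x ≡ y mod_) K≡2N

  apart-by-one : ∀ {x y} → ∣ x - y ∣ ≡ 1 → ¬ (x ≡ y mod K)
  apart-by-one ∣x-y∣≡1 (congruent K∣x-y) =
    contradiction (ℕ.∣1⇒≡1 (subst (K ℕ.∣_) ∣x-y∣≡1 (∣⇒∣ᵤ K∣x-y))) λ ()

  open Halves N K≡N+N

  upper-0 : upper (Rₖ.reduce (+ 0)) ≡ false
  upper-0 = refl

  upper-2 : upper (Rₖ.reduce (+ 2)) ≡ false
  upper-2 = upper-false (subst (ℕ._< N) (sym (Rₖ.toℕ-reduce-small 2<K)) 2<N)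
    where 2<K : 2 ℕ.< K
          2<K = ℕ.<-≤-trans 2<N (subst (N ℕ.≤_) (sym K≡N+N) (ℕ.m≤m+n N N))

  upper-−1 : upper (Rₖ.reduce (- + 1)) ≡ true
  upper-−1 = upper-true (subst (N ℕ.≤_) (sym (Rₖ.toℕ-reduce (- + 1)))
    (ℕ.≤-trans (ℕ.*-monoˡ-≤ n (ℕ.n≤1+n 2)) (ℕ.≤-trans (ℕ.m≤n+m (3 ℕ.* n) d) (ℕ.n≤1+n _))))

  -- The reflection bit of θ x records the half of ℤ_K containing b: this is what keeps
  -- x ↦ x ⊕ θ x injective although b ↦ 2b is two-to-one on ℤ_K.
  θℤ : Bool → Dihℤ → Dihℤ
  θℤ h (a , b , false) = (a , b + + 2 , h)
  θℤ h (a , b , true)  = (- a , + 1 - b , h)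

  θ : G → G
  θ x = ⟦ θℤ (upper (snd x)) (lift x) ⟧

  θ-⟦⟧ : ∀ X → θ ⟦ X ⟧ ≡ ⟦ θℤ (upper (snd ⟦ X ⟧)) X ⟧
  θ-⟦⟧ (a , b , false) = ⟦⟧-cong (Rₘ.reduce-mod a) (mod-+ (Rₖ.reduce-mod b) (mod-reflexive refl))
  θ-⟦⟧ (a , b , true)  =
    ⟦⟧-cong (mod-neg (Rₘ.reduce-mod a)) (mod-+ (mod-reflexive {x = + 1} refl) (mod-neg (Rₖ.reduce-mod b)))

  θ-at : ∀ X {h} → upper (snd ⟦ X ⟧) ≡ h → θ ⟦ X ⟧ ≡ ⟦ θℤ h X ⟧
  θ-at X upper≡h = trans (θ-⟦⟧ X) (cong (λ h → ⟦ θℤ h X ⟧) upper≡h)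

  private
    sum-form : ∀ x y → (x + + 2) - (+ 1 - y) ≡ (+ 1 + (x + y)) - + 0
    sum-form = solve-∀

  θ-injective : Injective _≡_ _≡_ θ
  θ-injective {x@(⟨ a , b , false ⟩)} {y@(⟨ a′ , b′ , false ⟩)} eq =
    let a≡a′ , b+2≡b′+2 , _ = ⟦⟧-injective (θℤ (upper b) (lift x)) (θℤ (upper b′) (lift y)) eq
    in lift-mod-injective a≡a′ (mod-+-cancelʳ {c = + 2} b+2≡b′+2)
  θ-injective {x@(⟨ a , b , true ⟩)} {y@(⟨ a′ , b′ , true ⟩)} eq =
    let -a≡-a′ , 1-b≡1-b′ , _ = ⟦⟧-injective (θℤ (upper b) (lift x)) (θℤ (upper b′) (lift y)) eq
    in lift-mod-injective (mod-neg-cancel -a≡-a′) (mod-neg-cancel (mod-+-cancelˡ {c = + 1} 1-b≡1-b′))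
  θ-injective {x@(⟨ a , b , false ⟩)} {y@(⟨ a′ , b′ , true ⟩)} eq =
    let _ , b+2≡1-b′ , same = ⟦⟧-injective (θℤ (upper b) (lift x)) (θℤ (upper b′) (lift y)) eq
    in contradiction (mod-resp (sum-form (+ toℕ b) (+ toℕ b′)) b+2≡1-b′) (same-half-sum {b} {b′} same)
  θ-injective {x@(⟨ a , b , true ⟩)} {y@(⟨ a′ , b′ , false ⟩)} eq =
    let _ , 1-b≡b′+2 , same = ⟦⟧-injective (θℤ (upper b) (lift x)) (θℤ (upper b′) (lift y)) eq
    in contradiction (mod-resp (sum-form (+ toℕ b′) (+ toℕ b)) (mod-sym 1-b≡b′+2))
                     (same-half-sum {b′} {b} (sym same))

  private
    lifted-⊕θ : ∀ x → x ⊕ θ x ≡ ⟦ lift x · θℤ (upper (snd x)) (lift x) ⟧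
    lifted-⊕θ x = trans (cong (_⊕ θ x) (sym (⟦lift⟧ x))) (⟦⟧-hom (lift x) _)

    lifted-injective : ∀ {x y} → x ⊕ θ x ≡ y ⊕ θ y →
                       lift x · θℤ (upper (snd x)) (lift x) ∼ lift y · θℤ (upper (snd y)) (lift y)
    lifted-injective {x} {y} eq = ⟦⟧-injective _ _ (trans (sym (lifted-⊕θ x)) (trans eq (lifted-⊕θ y)))

    same-canonical : ∀ {b b′ : Fin K} → b ≡ b′ → + toℕ b ≡ + toℕ b′ mod K
    same-canonical b≡b′ = mod-reflexive (cong (λ b → + toℕ b) b≡b′)

    double-+ : ∀ x y → (x + x) - (y + y) ≡ + 2 * x - + 2 * y
    double-+ = solve-∀
    double-- : ∀ x y → (x - - x) - (y - - y) ≡ + 2 * x - + 2 * y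
    double-- = solve-∀
    double-+2 : ∀ x y → (x + (x + + 2)) - (y + (y + + 2)) ≡ + 2 * x - + 2 * y
    double-+2 = solve-∀
    double-−1 : ∀ x y → (x - (+ 1 - x)) - (y - (+ 1 - y)) ≡ + 2 * x - + 2 * y
    double-−1 = solve-∀
    odd-gap : ∀ x y → (x + (x + + 2)) - (y - (+ 1 - y)) ≡ + 2 * (x - y + + 1) + + 1
    odd-gap = solve-∀

  ⊕θ-injective : Injective _≡_ _≡_ (λ x → x ⊕ θ x)
  ⊕θ-injective {x@(⟨ a , b , false ⟩)} {y@(⟨ a′ , b′ , false ⟩)} eq =
    let 2a≡2a′ , 2b+2≡2b′+2 , same = lifted-injective {x} {y} eq
    in lift-mod-injective
         (mod-halve-odd t (mod-resp (double-+ (+ toℕ a) (+ toℕ a′)) 2a≡2a′))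
         (same-canonical (same-half-unique same
                                           (halve-K (mod-resp (double-+2 (+ toℕ b) (+ toℕ b′)) 2b+2≡2b′+2))))
  ⊕θ-injective {x@(⟨ a , b , true ⟩)} {y@(⟨ a′ , b′ , true ⟩)} eq =
    let 2a≡2a′ , 2b-1≡2b′-1 , same = lifted-injective {x} {y} eq
    in lift-mod-injective
         (mod-halve-odd t (mod-resp (double-- (+ toℕ a) (+ toℕ a′)) 2a≡2a′))
         (same-canonical (same-half-unique (Bool.not-injective same)
                                           (halve-K (mod-resp (double-−1 (+ toℕ b) (+ toℕ b′)) 2b-1≡2b′-1))))
  ⊕θ-injective {x@(⟨ a , b , false ⟩)} {y@(⟨ a′ , b′ , true ⟩)} eq =
    let _ , 2b+2≡2b′-1 , _ = lifted-injective {x} {y} eq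
    in contradiction 2b+2≡2b′-1
                     (odd-difference-K {z = + toℕ b - + toℕ b′ + + 1} (odd-gap (+ toℕ b) (+ toℕ b′)))
  ⊕θ-injective {x@(⟨ a , b , true ⟩)} {y@(⟨ a′ , b′ , false ⟩)} eq =
    let _ , 2b-1≡2b′+2 , _ = lifted-injective {x} {y} eq
    in contradiction (mod-sym 2b-1≡2b′+2)
                     (odd-difference-K {z = + toℕ b′ - + toℕ b + + 1} (odd-gap (+ toℕ b′) (+ toℕ b)))

  σ̃ : Dihℤ
  σ̃ = (+ 0 , + 2 , false)

  σ ρ : G
  σ = ⟦ σ̃ ⟧
  ρ = ⟦ + 8 , + 0 , false ⟧

  private
    divides-times-zero : ∀ {i} x → i ∣ x * + 0
    divides-times-zero x = subst (_ ∣_) (sym (ℤ.*-zeroʳ x)) (divides (+ 0) refl)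

    negate-factor : ∀ {i} x y → i ∣ x * y → i ∣ x * - y
    negate-factor x y = subst (_ ∣_) (ℤ.neg-distribʳ-* x y) ∘ ∣m⇒∣-m

  ρ-order : IsOrder ρ m
  ρ-order = rotation-order {+ 8} {+ 0} (s≤s z≤n) (∣m⇒∣m*n (+ 8) ∣-refl) (divides-times-zero {+ K} (+ m)) minimal
    where
    octuple : ∀ k → k * + 8 ≡ + 2 * (+ 2 * (+ 2 * k))
    octuple = solve-∀
    minimal : ∀ k → + m ∣ + k * + 8 → + K ∣ + k * + 0 → m ℕ.∣ k
    minimal k m∣8k _ = ∣⇒∣ᵤ (halve-odd t (halve-odd t (halve-odd t (subst (+ m ∣_) (octuple (+ k)) m∣8k))))

  vertical-order : ∀ {b} → + K ∣ + N * b → (∀ k → + K ∣ + k * b → + K ∣ + k * + 2) →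
                   IsOrder ⟦ + 0 , b , false ⟧ N
  vertical-order {b} K∣Nb to-2 =
    rotation-order {+ 0} {b} (ℕ.<-trans (s≤s z≤n) 2<N) (divides-times-zero {+ m} (+ N)) K∣Nb minimal
    where
    minimal : ∀ k → + m ∣ + k * + 0 → + K ∣ + k * b → N ℕ.∣ k
    minimal k _ K∣kb = ∣⇒∣ᵤ (halve-even N (subst₂ _∣_ (cong +_ K≡2N) (ℤ.*-comm (+ k) (+ 2)) (to-2 k K∣kb)))

  K∣N*2 : + K ∣ + N * + 2
  K∣N*2 = subst (+ K ∣_) (trans (cong +_ (trans K≡2N (ℕ.*-comm 2 N))) (ℤ.pos-* N 2)) ∣-refl

  σ-order : IsOrder σ N
  σ-order = vertical-order K∣N*2 (λ _ → id)

  σ⁻¹-order : IsOrder (σ ⁻¹) N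
  σ⁻¹-order = IsOrder-resp (⟦⟧-inv σ̃)
    (vertical-order { - + 2} (negate-factor (+ N) (+ 2) K∣N*2) (λ k → negate-factor (+ k) (- + 2)))

  L : List ℕ
  L = m ∷ replicate (m ℕ.* K ℕ.* 2 ℕ.∸ 1) N

  ψ : G → G
  ψ x = (x ⊕ θ x) \\ σ

  ψ-injective : Injective _≡_ _≡_ ψ
  ψ-injective = ⊕θ-injective ∘ ⁻¹-injective ∘ ∙-cancelʳ σ _ _

  ψℤ : Bool → Dihℤ → Dihℤ
  ψℤ h X = invℤ (X · θℤ h X) · σ̃

  oddRow : G → G → G → Fin 3 → G
  oddRow x y z zero             = x
  oddRow x y z (suc zero)       = θ y
  oddRow x y z (suc (suc zero)) = ψ z

  complete-row : ∀ x → rowSum 2 (oddRow x x x) ≡ σ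
  complete-row x = \\-leftDividesˡ (x ⊕ θ x) σ

  odd-row-value : ∀ X Y Z {h h′} → upper (snd ⟦ Y ⟧) ≡ h → upper (snd ⟦ Z ⟧) ≡ h′ →
                  rowSum 2 (oddRow ⟦ X ⟧ ⟦ Y ⟧ ⟦ Z ⟧) ≡ ⟦ (X · θℤ h Y) · ψℤ h′ Z ⟧
  odd-row-value X Y Z {h} {h′} upperY upperZ = begin
    (⟦ X ⟧ ⊕ θ ⟦ Y ⟧) ⊕ ((⟦ Z ⟧ ⊕ θ ⟦ Z ⟧) ⁻¹ ⊕ σ)
      ≡⟨ cong₂ (λ u v → (⟦ X ⟧ ⊕ u) ⊕ ((⟦ Z ⟧ ⊕ v) ⁻¹ ⊕ σ)) (θ-at Y upperY) (θ-at Z upperZ) ⟩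
    (⟦ X ⟧ ⊕ ⟦ θℤ h Y ⟧) ⊕ ((⟦ Z ⟧ ⊕ ⟦ θℤ h′ Z ⟧) ⁻¹ ⊕ σ)
      ≡⟨ cong₂ (λ u v → u ⊕ (v ⁻¹ ⊕ σ)) (⟦⟧-hom X (θℤ h Y)) (⟦⟧-hom Z (θℤ h′ Z)) ⟩
    ⟦ X · θℤ h Y ⟧ ⊕ (⟦ Z · θℤ h′ Z ⟧ ⁻¹ ⊕ σ)
      ≡⟨ cong (λ v → ⟦ X · θℤ h Y ⟧ ⊕ (v ⊕ σ)) (⟦⟧-inv (Z · θℤ h′ Z)) ⟩
    ⟦ X · θℤ h Y ⟧ ⊕ (⟦ invℤ (Z · θℤ h′ Z) ⟧ ⊕ σ)
      ≡⟨ cong (⟦ X · θℤ h Y ⟧ ⊕_) (⟦⟧-hom (invℤ (Z · θℤ h′ Z)) σ̃) ⟩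
    ⟦ X · θℤ h Y ⟧ ⊕ ⟦ ψℤ h′ Z ⟧
      ≡⟨ ⟦⟧-hom (X · θℤ h Y) (ψℤ h′ Z) ⟩
    ⟦ (X · θℤ h Y) · ψℤ h′ Z ⟧ ∎
    where open ≡-Reasoning

  -- On these points the integer products in odd-row-value evaluate to the lifts of ρ, σ⁻¹ and σ.
  P Q R : Dihℤ
  P = (+ 1 , + 0 , false)
  Q = (- + 3 , - + 1 , false)
  R = (- + 5 , + 2 , true)

  odd-base : RSM-orders m n 2 L
  odd-base = rsm-one-exceptional row ⟦ P ⟧ columns-injective (IsOrder-resp row-P ρ-order)
    (other-than-p (λ x → IsOrder (rowSum 2 (row x)) N)
                  (IsOrder-resp row-Q σ⁻¹-order) (IsOrder-resp row-R σ-order) row-fixed)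
    where
    P≢Q : ⟦ P ⟧ ≢ ⟦ Q ⟧
    P≢Q eq = apart-by-one refl (proj₁ (proj₂ (⟦⟧-injective P Q eq)))
    Q≢R : ⟦ Q ⟧ ≢ ⟦ R ⟧
    Q≢R = tau-apart λ ()
    P≢R : ⟦ P ⟧ ≢ ⟦ R ⟧
    P≢R = tau-apart λ ()
    open ThreeCycle _≟Γ_ P≢Q Q≢R P≢R

    row : G → Fin 3 → G
    row x = oddRow x (cycle x) (cycle⁻¹ x)

    columns-injective : ∀ j → Injective _≡_ _≡_ (λ x → row x j)
    columns-injective zero             = id
    columns-injective (suc zero)       = cycle-injective ∘ θ-injective
    columns-injective (suc (suc zero)) = cycle⁻¹-injective ∘ ψ-injective

    row-at : ∀ {x y z} → cycle x ≡ y → cycle⁻¹ x ≡ z → rowSum 2 (row x) ≡ rowSum 2 (oddRow x y z)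
    row-at {x} = cong₂ (λ y z → rowSum 2 (oddRow x y z))

    row-P : rowSum 2 (row ⟦ P ⟧) ≡ ρ
    row-P = trans (row-at cycle-p cycle⁻¹-p) (odd-row-value P Q R upper-−1 upper-2)
    row-Q : rowSum 2 (row ⟦ Q ⟧) ≡ σ ⁻¹
    row-Q = trans (row-at cycle-q cycle⁻¹-q) (trans (odd-row-value Q R P upper-2 upper-0) (sym (⟦⟧-inv σ̃)))
    row-R : rowSum 2 (row ⟦ R ⟧) ≡ σ
    row-R = trans (row-at cycle-r cycle⁻¹-r) (odd-row-value R P Q upper-0 upper-−1)
    row-fixed : ∀ {x} → x ≢ ⟦ P ⟧ → x ≢ ⟦ Q ⟧ → x ≢ ⟦ R ⟧ → IsOrder (rowSum 2 (row x)) N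
    row-fixed {x} x≢P x≢Q x≢R =
      IsOrder-resp (trans (row-at (cycle-fixes x≢P x≢Q x≢R) (cycle⁻¹-fixes x≢P x≢Q x≢R)) (complete-row x))
                   σ-order

  evenRow : G → G → Fin 4 → G
  evenRow x y zero                   = x
  evenRow x y (suc zero)             = σ // y
  evenRow x y (suc (suc zero))       = x
  evenRow x y (suc (suc (suc zero))) = y ⁻¹

  twist-value : ∀ X Y → ⟦ X ⟧ ⊕ (σ // ⟦ Y ⟧) ≡ ⟦ X · (σ̃ · invℤ Y) ⟧
  twist-value X Y = begin
    ⟦ X ⟧ ⊕ (σ ⊕ ⟦ Y ⟧ ⁻¹)        ≡⟨ cong (λ y → ⟦ X ⟧ ⊕ (σ ⊕ y)) (⟦⟧-inv Y) ⟩
    ⟦ X ⟧ ⊕ (σ ⊕ ⟦ invℤ Y ⟧)      ≡⟨ cong (⟦ X ⟧ ⊕_) (⟦⟧-hom σ̃ (invℤ Y)) ⟩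
    ⟦ X ⟧ ⊕ ⟦ σ̃ · invℤ Y ⟧        ≡⟨ ⟦⟧-hom X (σ̃ · invℤ Y) ⟩
    ⟦ X · (σ̃ · invℤ Y) ⟧          ∎
    where open ≡-Reasoning

  even-row-value : ∀ X Y → rowSum 3 (evenRow ⟦ X ⟧ ⟦ Y ⟧) ≡ ⟦ ((X · (σ̃ · invℤ Y)) · X) · invℤ Y ⟧
  even-row-value X Y = begin
    ((⟦ X ⟧ ⊕ (σ // ⟦ Y ⟧)) ⊕ ⟦ X ⟧) ⊕ ⟦ Y ⟧ ⁻¹
      ≡⟨ cong₂ (λ u v → (u ⊕ ⟦ X ⟧) ⊕ v) (twist-value X Y) (⟦⟧-inv Y) ⟩
    (⟦ X · (σ̃ · invℤ Y) ⟧ ⊕ ⟦ X ⟧) ⊕ ⟦ invℤ Y ⟧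
      ≡⟨ cong (_⊕ ⟦ invℤ Y ⟧) (⟦⟧-hom (X · (σ̃ · invℤ Y)) X) ⟩
    ⟦ (X · (σ̃ · invℤ Y)) · X ⟧ ⊕ ⟦ invℤ Y ⟧
      ≡⟨ ⟦⟧-hom ((X · (σ̃ · invℤ Y)) · X) (invℤ Y) ⟩
    ⟦ ((X · (σ̃ · invℤ Y)) · X) · invℤ Y ⟧ ∎
    where open ≡-Reasoning

  conjugate-row : ∀ x → rowSum 3 (evenRow x x) ≡ σ ⊎ rowSum 3 (evenRow x x) ≡ σ ⁻¹
  conjugate-row x = Sum.map (trans cancel) (trans cancel) (conjugate (lifted-view x))
    where
    cancel : rowSum 3 (evenRow x x) ≡ x ⊕ (σ // x)
    cancel = //-rightDividesʳ x (x ⊕ (σ // x))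
    conjugate : ∀ {x} → Lifted x → x ⊕ (σ // x) ≡ σ ⊎ x ⊕ (σ // x) ≡ σ ⁻¹
    conjugate (lifted (a , b , false)) =
      inj₁ (trans (twist-value (a , b , false) (a , b , false)) (cong ⟦_⟧ (dihℤ-≡ (cancel-a a) (cancel-b b))))
      where cancel-a : ∀ a → a + (+ 0 + - a) ≡ + 0
            cancel-a = solve-∀
            cancel-b : ∀ b → b + (+ 2 + - b) ≡ + 2
            cancel-b = solve-∀
    conjugate (lifted (a , b , true)) =
      inj₂ (trans (twist-value (a , b , true) (a , b , true))
                  (trans (cong ⟦_⟧ (dihℤ-≡ (cancel-a a) (cancel-b b))) (sym (⟦⟧-inv σ̃))))
      where cancel-a : ∀ a → a - (+ 0 + a) ≡ + 0
            cancel-a = solve-∀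
            cancel-b : ∀ b → b - (+ 2 + b) ≡ - + 2
            cancel-b = solve-∀

  -- Likewise, even-row-value evaluates to the lifts of ρ, σ and σ⁻¹ on these points.
  P′ Q′ R′ : Dihℤ
  P′ = (+ 1 , + 0 , false)
  Q′ = (- + 3 , + 1 , false)
  R′ = (+ 0 , - + 1 , true)

  even-base : RSM-orders m n 3 L
  even-base = rsm-one-exceptional row ⟦ P′ ⟧ columns-injective (IsOrder-resp row-P ρ-order)
    (other-than-p (λ x → IsOrder (rowSum 3 (row x)) N)
                  (IsOrder-resp row-Q σ-order) (IsOrder-resp row-R σ⁻¹-order) row-fixed)
    where
    P≢Q : ⟦ P′ ⟧ ≢ ⟦ Q′ ⟧
    P≢Q eq = apart-by-one refl (proj₁ (proj₂ (⟦⟧-injective P′ Q′ eq)))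
    Q≢R : ⟦ Q′ ⟧ ≢ ⟦ R′ ⟧
    Q≢R = tau-apart λ ()
    P≢R : ⟦ P′ ⟧ ≢ ⟦ R′ ⟧
    P≢R = tau-apart λ ()
    open ThreeCycle _≟Γ_ P≢Q Q≢R P≢R

    row : G → Fin 4 → G
    row x = evenRow x (cycle x)

    columns-injective : ∀ j → Injective _≡_ _≡_ (λ x → row x j)
    columns-injective zero                   = id
    columns-injective (suc zero)             = cycle-injective ∘ ⁻¹-injective ∘ ∙-cancelˡ σ _ _
    columns-injective (suc (suc zero))       = id
    columns-injective (suc (suc (suc zero))) = cycle-injective ∘ ⁻¹-injective

    row-at : ∀ {x y} → cycle x ≡ y → rowSum 3 (row x) ≡ rowSum 3 (evenRow x y)
    row-at {x} = cong (λ y → rowSum 3 (evenRow x y))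

    row-P : rowSum 3 (row ⟦ P′ ⟧) ≡ ρ
    row-P = trans (row-at cycle-p) (even-row-value P′ Q′)
    row-Q : rowSum 3 (row ⟦ Q′ ⟧) ≡ σ
    row-Q = trans (row-at cycle-q) (even-row-value Q′ R′)
    row-R : rowSum 3 (row ⟦ R′ ⟧) ≡ σ ⁻¹
    row-R = trans (row-at cycle-r) (trans (even-row-value R′ P′) (sym (⟦⟧-inv σ̃)))
    row-fixed : ∀ {x} → x ≢ ⟦ P′ ⟧ → x ≢ ⟦ Q′ ⟧ → x ≢ ⟦ R′ ⟧ → IsOrder (rowSum 3 (row x)) N
    row-fixed {x} x≢P x≢Q x≢R =
      [ (λ conj≡σ → IsOrder-resp (trans fixed conj≡σ) σ-order)
      , (λ conj≡σ⁻¹ → IsOrder-resp (trans fixed conj≡σ⁻¹) σ⁻¹-order)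
      ]′ (conjugate-row x)
      where fixed = row-at (cycle-fixes x≢P x≢Q x≢R)

  rsm : ∀ g → 2 ℕ.≤ g → RSM-orders m n g L
  rsm = rsm-from-bases odd-base even-base

odd⇒suc-double : ∀ {m} → 2 ℕ.∤ m → ∃[ t ] m ≡ suc (2 ℕ.* t)
odd⇒suc-double {zero} 2∤0 = contradiction (2 ℕ.∣0) 2∤0
odd⇒suc-double {suc zero} _ = 0 , refl
odd⇒suc-double {suc (suc m)} 2∤2+m with odd⇒suc-double {m} (2∤2+m ∘ ℕ.∣m∣n⇒∣m+n ℕ.∣-refl)
... | t , refl = suc t , cong (2 ℕ.+_) (sym (ℕ.+-suc t (t ℕ.+ 0)))

open import Data.Nat using (_+_; _*_; _∸_; _≤_)

-- The construction needs only m odd and n ≥ 2.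
theorem3p6 : (g m n : ℕ) → 3 ≤ g → 1 ≤ m → 3 ≤ n → 2 ∤ m → 2 ∤ n →
    RSM-orders m n (g ∸ 1) (replicate 1 m ++ replicate (8 * m * n ∸ 1) (2 * n))
theorem3p6 (suc g) m n@(suc (suc (suc d))) (s≤s 2≤g) _ (s≤s (s≤s (s≤s _))) 2∤m _ with odd⇒suc-double 2∤m
... | t , refl = subst (λ size → RSM-orders m n g (m ∷ replicate (size ∸ 1) (2 * n)))
                       (size m n) (Construction.rsm t (suc d) g 2≤g)
  where
  size : ∀ m n → m * (4 * n) * 2 ≡ 8 * m * n
  size = ℕ-Ring.solve-∀
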